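{- Let $G=(V,E)$ and $G'=(V',E')$ be finite simple graphs with $V\cap V'=\emptyset$, and let $G\oplus_{v}G'$ be the vertex sum formed by identifying $u\in V$ and $u'\in V'$ into the vertex $v$. Suppose $S\subseteq V\setminus\{u\}$ and $S'\subseteq V'\setminus\{u'\}$ are maximal failed zero forcing sets of $G$ and $G'$, respectively. Then $S\cup S'$ is a failed zero forcing set of $G\oplus_{v}G'$. Moreover, $S\cup S'$ is a maximal failed zero forcing set of $G\oplus_{v}G'$ if and only if $S\cup S'\cup\{v\}$ is a zero forcing set of $G\oplus_{v}G'$.
   Context: The vertex sum $G\oplus_v G'$ has vertex set $(V\setminus\{u\})\cup(V'\setminus\{u'\})\cup\{v\}$; its edges are those of $G$ not incident to $u$, those of $G'$ not incident to $u'$, and the edges $\{v,w\}$ for $w\in N_G(u)\cup N_{G'}(u')$. Zero forcing: starting from an initial set $S$ of filled vertices, repeatedly apply the rule that a filled vertex $x$ forces (fills) a non-filled vertex $w$ if $w$ is the only non-filled neighbor of $x$, until no more forces are possible. $S$ is a zero forcing set if all vertices end up filled, otherwise a failed zero forcing set. A failed zero forcing set is maximal if it is not properly contained in another failed zero forcing set (equivalently, adding any vertex to it yields a zero forcing set). -}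

module Defs where

open import Data.Nat using (ℕ)
open import Data.Bool using (Bool; true; false; _∨_; not; T)
open import Data.Fin using (Fin)
open import Data.Fin.Properties using () renaming (_≟_ to _≟F_)
open import Data.Sum using (_⊎_; inj₁; inj₂)
open import Data.Product using (Σ; _,_; _×_)
open import Data.Unit using (⊤; tt)
open import Relation.Nullary using (¬_; yes; no; does)
open import Relation.Binary.Definitions using (DecidableEquality)
open import Relation.Binary.PropositionalEquality using (_≡_; refl; cong)

record SimpleGraph (n : ℕ) : Set where
  field
    adj    : Fin n → Fin n → Bool
    sym    : ∀ x y → adj x y ≡ adj y x
    irrefl : ∀ x → adj x x ≡ false

module ZeroForcing {V : Set} (_≟_ : DecidableEquality V) (adj : V → V → Bool) where

  -- The final set of filled vertices obtained from S by exhaustively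
  -- applying the forcing rule: x filled, w a neighbour of x, and every
  -- other neighbour y ≠ w of x filled  ⇒  x forces w.
  data Filled (S : V → Bool) : V → Set where
    initial : ∀ {w} → S w ≡ true → Filled S w
    force   : ∀ {w} (x : V) → Filled S x → adj x w ≡ true
            → (∀ y → adj x y ≡ true → ¬ (y ≡ w) → Filled S y)
            → Filled S w

  IsZeroForcingSet : (V → Bool) → Set
  IsZeroForcingSet S = ∀ w → Filled S w

  IsFailedZeroForcingSet : (V → Bool) → Set
  IsFailedZeroForcingSet S = ¬ IsZeroForcingSet S

  insert : V → (V → Bool) → (V → Bool)
  insert x S y = S y ∨ does (y ≟ x)

  IsMaximalFailedZeroForcingSet : (V → Bool) → Set
  IsMaximalFailedZeroForcingSet S =
    IsFailedZeroForcingSet S × (∀ x → S x ≡ false → IsZeroForcingSet (insert x S))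

-- Vertex sum  G ⊕_v G'  identifying u ∈ V(G) and u' ∈ V(G') into v.
-- Vertex set: (V ∖ {u}) ⊎ (V' ∖ {u'}) ⊎ {v}  (disjoint by construction).

_≢ᵇ_ : ∀ {n} → Fin n → Fin n → Set
x ≢ᵇ u = T (not (does (x ≟F u)))

data SumVertex (n m : ℕ) (u : Fin n) (u' : Fin m) : Set where
  left  : (x : Fin n) → x ≢ᵇ u → SumVertex n m u u'
  right : (y : Fin m) → y ≢ᵇ u' → SumVertex n m u u'
  v     : SumVertex n m u u'

private
  T-irr : ∀ {b} (p q : T b) → p ≡ q
  T-irr {true} tt tt = refl

_≟V_ : ∀ {n m u u'} → DecidableEquality (SumVertex n m u u')
left x p ≟V left x' p' with x ≟F x'
... | yes refl with T-irr p p'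
...   | refl = yes refl
left x p ≟V left x' p' | no ne = no λ { refl → ne refl }
left _ _ ≟V right _ _ = no λ ()
left _ _ ≟V v = no λ ()
right _ _ ≟V left _ _ = no λ ()
right y p ≟V right y' p' with y ≟F y'
... | yes refl with T-irr p p'
...   | refl = yes refl
right y p ≟V right y' p' | no ne = no λ { refl → ne refl }
right _ _ ≟V v = no λ ()
v ≟V left _ _ = no λ ()
v ≟V right _ _ = no λ ()
v ≟V v = yes refl

vertexSumAdj : ∀ {n m} (G : SimpleGraph n) (G' : SimpleGraph m) (u : Fin n) (u' : Fin m)
             → SumVertex n m u u' → SumVertex n m u u' → Bool
vertexSumAdj G G' u u' (left x _)  (left y _)  = SimpleGraph.adj G x y
vertexSumAdj G G' u u' (left x _)  (right _ _) = false
vertexSumAdj G G' u u' (left x _)  v           = SimpleGraph.adj G x u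
vertexSumAdj G G' u u' (right _ _) (left _ _)  = false
vertexSumAdj G G' u u' (right x _) (right y _) = SimpleGraph.adj G' x y
vertexSumAdj G G' u u' (right x _) v           = SimpleGraph.adj G' x u'
vertexSumAdj G G' u u' v           (left y _)  = SimpleGraph.adj G u y
vertexSumAdj G G' u u' v           (right y _) = SimpleGraph.adj G' u' y
vertexSumAdj G G' u u' v           v           = false

sumSet : ∀ {n m u u'} → (Fin n → Bool) → (Fin m → Bool) → SumVertex n m u u' → Bool
sumSet S S' (left x _)  = S x
sumSet S S' (right y _) = S' y
sumSet S S' v           = false

module ZF {n} (G : SimpleGraph n) = ZeroForcing _≟F_ (SimpleGraph.adj G)
module ZFsum {n m} (G : SimpleGraph n) (G' : SimpleGraph m) (u : Fin n) (u' : Fin m) =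
  ZeroForcing (_≟V_ {n} {m} {u} {u'}) (vertexSumAdj G G' u u')

{-# OPTIONS --safe #-}
-- A maximal failed zero forcing set is closed under forcing: a vertex it forces
-- could be added to it without enlarging its closure.  In the vertex sum every
-- vertex other than v lies in a copy of G − u or G' − u' whose neighbourhood is
-- the one it has in G (resp. G'), with v in the role of u and v ∉ S ∪ S'; hence
-- S ∪ S' is again closed under forcing and never fills v.  Conversely, for
-- a ∉ S the set S ∪ {a} is a zero forcing set of G, and replaying its forces in
-- the sum, each step either lifts verbatim or needs v to be filled already; so
-- S ∪ S' ∪ {a} fills v, and therefore everything if S ∪ S' ∪ {v} does.
module Submission where

open import Defs
open import Data.Nat using (ℕ)
open import Data.Bool using (Bool; true; false; _∨_)
open import Data.Bool.Properties using (∨-zeroʳ; T-irrelevant) renaming (_≟_ to _≟B_)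
open import Data.Empty using (⊥-elim)
open import Data.Fin using (Fin; zero; suc)
open import Data.Fin.Properties using (∀-cons) renaming (_≟_ to _≟F_)
open import Data.Product using (_×_; _,_; ∃; proj₂)
open import Data.Sum using (_⊎_; inj₁; inj₂; [_,_])
open import Data.Unit using (tt)
open import Function using (_∘_; id)
open import Function.Bundles using (_⇔_; mk⇔)
open import Relation.Nullary using (Dec; yes; no; does; ¬?)
open import Relation.Nullary.Decidable using (_×-dec_)
open import Relation.Unary using (Decidable)
open import Relation.Binary.Definitions using (DecidableEquality)
open import Relation.Binary.PropositionalEquality
  using (_≡_; _≢_; _≗_; refl; sym; trans; cong; subst)

∀⊎⇒⊎∀ : ∀ {n} {B : Set} {P C : Fin n → Set} → Decidable P
       → (∀ y → P y → B ⊎ C y) → B ⊎ (∀ y → P y → C y)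
∀⊎⇒⊎∀ {ℕ.zero}  P? h = inj₂ λ ()
∀⊎⇒⊎∀ {ℕ.suc n} P? h with ∀⊎⇒⊎∀ (P? ∘ suc) (h ∘ suc) | P? zero
... | inj₁ b | _     = inj₁ b
... | inj₂ g | no ¬p = inj₂ (∀-cons (⊥-elim ∘ ¬p) g)
... | inj₂ g | yes p with h zero p
...   | inj₁ b = inj₁ b
...   | inj₂ c = inj₂ (∀-cons (λ _ → c) g)

_⊆_ : ∀ {V : Set} → (V → Bool) → (V → Set) → Set
R ⊆ P = ∀ z → R z ≡ true → P z

module ZeroForcingProperties {V : Set} (_≟_ : DecidableEquality V) (adj : V → V → Bool) where
  open ZeroForcing _≟_ adj

  insert-self : ∀ x S → insert x S x ≡ true
  insert-self x S with x ≟ x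
  ... | yes _  = ∨-zeroʳ (S x)
  ... | no x≢x = ⊥-elim (x≢x refl)

  insert-⊇ : ∀ {x S z} → S z ≡ true → insert x S z ≡ true
  insert-⊇ {x} {z = z} Sz = cong (_∨ does (z ≟ x)) Sz

  insert-⊆ : ∀ {x R P} → P x → R ⊆ P → insert x R ⊆ P
  insert-⊆ {x} {R} Px R⊆P z with R z in Rz | z ≟ x
  ... | true  | _        = λ _ → R⊆P z Rz
  ... | false | yes refl = λ _ → Px
  ... | false | no _     = λ ()

  Filled-trans : ∀ {R S} → R ⊆ Filled S → ∀ {w} → Filled R w → Filled S w
  Filled-trans R⊆S (initial Rw)           = R⊆S _ Rw
  Filled-trans R⊆S (force x Rx xw others) =
    force x (Filled-trans R⊆S Rx) xw (λ y xy y≢w → Filled-trans R⊆S (others y xy y≢w))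

  IsZeroForcingSet-⊆ : ∀ {R S} → R ⊆ Filled S → IsZeroForcingSet R → IsZeroForcingSet S
  IsZeroForcingSet-⊆ R⊆S zfs w = Filled-trans R⊆S (zfs w)

  IsZeroForcingSet-exchange : ∀ {S x y} → Filled (insert x S) y
                            → IsZeroForcingSet (insert y S) → IsZeroForcingSet (insert x S)
  IsZeroForcingSet-exchange {S} Sx⇒y =
    IsZeroForcingSet-⊆ (insert-⊆ Sx⇒y (λ _ Sz → initial (insert-⊇ {S = S} Sz)))

  IsForcingClosed : (V → Bool) → Set
  IsForcingClosed S = ∀ x w → S x ≡ true → adj x w ≡ true
                    → (∀ y → adj x y ≡ true → y ≢ w → S y ≡ true) → S w ≡ true

  Filled⇒∈ : ∀ {S} → IsForcingClosed S → ∀ {w} → Filled S w → S w ≡ true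
  Filled⇒∈ closed (initial Sw)           = Sw
  Filled⇒∈ closed (force x Sx xw others) =
    closed x _ (Filled⇒∈ closed Sx) xw (λ y xy y≢w → Filled⇒∈ closed (others y xy y≢w))

  maximalFailed⇒forcingClosed : ∀ {S} → IsMaximalFailedZeroForcingSet S → IsForcingClosed S
  maximalFailed⇒forcingClosed {S} (failed , maximal) x w Sx xw others with S w in Sw
  ... | true  = refl
  ... | false = ⊥-elim (failed (IsZeroForcingSet-⊆ (insert-⊆ forced (λ _ → initial)) (maximal w Sw)))
    where
    forced : Filled S w
    forced = force x (initial Sx) xw (λ y xy y≢w → initial (others y xy y≢w))

≢ᵇ⇒≢ : ∀ {n} {x u : Fin n} → x ≢ᵇ u → x ≢ u
≢ᵇ⇒≢ {x = x} {u} p with x ≟F u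
≢ᵇ⇒≢ () | yes _
≢ᵇ⇒≢ _  | no x≢u = x≢u

≢⇒≢ᵇ : ∀ {n} {x u : Fin n} → x ≢ u → x ≢ᵇ u
≢⇒≢ᵇ {x = x} {u} x≢u with x ≟F u
... | yes x≡u = x≢u x≡u
... | no _    = tt

record Branch {n} (G : SimpleGraph n) (u : Fin n) {W : Set} (adjH : W → W → Bool) (c : W) : Set where
  field
    embed           : (x : Fin n) → x ≢ᵇ u → W
    embed-injective : ∀ {x y p q} → embed x p ≡ embed y q → x ≡ y
    embed≢c         : ∀ {x p} → embed x p ≢ c
    adj-embed       : ∀ x y p q → adjH (embed x p) (embed y q) ≡ SimpleGraph.adj G x y
    adj-embed-c     : ∀ x p → adjH (embed x p) c ≡ SimpleGraph.adj G x u
    embed-neighbour : ∀ x p z → adjH (embed x p) z ≡ true → z ≡ c ⊎ ∃ λ y → ∃ λ q → z ≡ embed y q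

module BranchProperties {n} {G : SimpleGraph n} {u : Fin n} {W : Set} (_≟W_ : DecidableEquality W)
  {adjH : W → W → Bool} {c : W} (B : Branch G u adjH c) where
  open Branch B
  open SimpleGraph G using (adj)
  module FG = ZeroForcing _≟F_ adj
  module FH = ZeroForcing _≟W_ adjH
  module PG = ZeroForcingProperties _≟F_ adj
  module PH = ZeroForcingProperties _≟W_ adjH

  ι-by : ∀ {x} → Dec (x ≡ u) → W
  ι-by     (yes _)   = c
  ι-by {x} (no x≢u) = embed x (≢⇒≢ᵇ x≢u)

  ι : Fin n → W
  ι x = ι-by (x ≟F u)

  ι-u : ι u ≡ c
  ι-u with u ≟F u
  ... | yes _  = refl
  ... | no u≢u = ⊥-elim (u≢u refl)

  ι-by-embed : ∀ {x} (x≟u : Dec (x ≡ u)) p → ι-by x≟u ≡ embed x p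
  ι-by-embed (yes x≡u) p = ⊥-elim (≢ᵇ⇒≢ p x≡u)
  ι-by-embed (no _)    p = cong (embed _) (T-irrelevant _ p)

  ι-embed : ∀ x p → ι x ≡ embed x p
  ι-embed x = ι-by-embed (x ≟F u)

  ι-injective : ∀ {x y} → ι x ≡ ι y → x ≡ y
  ι-injective {x} {y} with x ≟F u | y ≟F u
  ... | yes refl | yes refl = λ _ → refl
  ... | yes _    | no _     = ⊥-elim ∘ embed≢c ∘ sym
  ... | no _     | yes _    = ⊥-elim ∘ embed≢c
  ... | no _     | no _     = embed-injective

  adj-embed-ι : ∀ x p y → adjH (embed x p) (ι y) ≡ adj x y
  adj-embed-ι x p y with y ≟F u
  ... | yes refl = adj-embed-c x p
  ... | no y≢u   = adj-embed x y p (≢⇒≢ᵇ y≢u)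

  embed-neighbour-ι : ∀ x p z → adjH (embed x p) z ≡ true → ∃ λ y → z ≡ ι y
  embed-neighbour-ι x p z xz with embed-neighbour x p z xz
  ... | inj₁ refl            = u , sym ι-u
  ... | inj₂ (y , q , refl) = y , sym (ι-embed y q)

  pullback-≗ : ∀ {T : W → Bool} {S : Fin n → Bool} → T c ≡ S u → (∀ x p → T (embed x p) ≡ S x) → T ∘ ι ≗ S
  pullback-≗ Tc≡Su Tembed≡S x with x ≟F u
  ... | yes refl = Tc≡Su
  ... | no x≢u   = Tembed≡S x (≢⇒≢ᵇ x≢u)

  embed-forcingClosed : ∀ {S T} → PG.IsForcingClosed S → T ∘ ι ≗ S
                      → ∀ a p w → T (embed a p) ≡ true → adjH (embed a p) w ≡ true
                      → (∀ y → adjH (embed a p) y ≡ true → y ≢ w → T y ≡ true) → T w ≡ true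
  embed-forcingClosed {S} {T} closed T∘ι≗S a p w Ta aw others with embed-neighbour-ι a p w aw
  ... | b , refl = trans (T∘ι≗S b) (closed a b Sa (trans (sym (adj-embed-ι a p b)) aw) othersG)
    where
    Sa : S a ≡ true
    Sa = trans (sym (T∘ι≗S a)) (trans (cong T (ι-embed a p)) Ta)
    othersG : ∀ y → adj a y ≡ true → y ≢ b → S y ≡ true
    othersG y ay y≢b =
      trans (sym (T∘ι≗S y)) (others (ι y) (trans (adj-embed-ι a p y) ay) (y≢b ∘ ι-injective))

  Filled-lift : ∀ {R T} → R ⊆ (FH.Filled T ∘ ι) → ∀ {w} → FG.Filled R w
              → FH.Filled T c ⊎ FH.Filled T (ι w)
  Filled-lift R⊆ (FG.initial Rw) = inj₂ (R⊆ _ Rw)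
  Filled-lift {R} {T} R⊆ {w} (FG.force x Rx xw others) with Filled-lift R⊆ Rx | x ≟F u
  ... | inj₁ Tc | _        = inj₁ Tc
  ... | inj₂ Tx | yes refl = inj₁ (subst (FH.Filled T) ι-u Tx)
  ... | inj₂ Tx | no x≢u
        with ∀⊎⇒⊎∀ (λ y → (adj x y ≟B true) ×-dec ¬? (y ≟F w))
                   (λ y (xy , y≢w) → Filled-lift R⊆ (others y xy y≢w))
  ...   | inj₁ Tc     = inj₁ Tc
  ...   | inj₂ Tother = inj₂ (FH.force (embed x p) (subst (FH.Filled T) (ι-embed x p) Tx)
                                       (trans (adj-embed-ι x p w) xw) othersH)
    where
    p : x ≢ᵇ u
    p = ≢⇒≢ᵇ x≢u
    othersH : ∀ z → adjH (embed x p) z ≡ true → z ≢ ι w → FH.Filled T z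
    othersH z xz z≢w with embed-neighbour-ι x p z xz
    ... | y , refl = Tother y (trans (sym (adj-embed-ι x p y)) xz , z≢w ∘ cong ι)

  zeroForcing⇒Filled-c : ∀ {R T} → R ⊆ (FH.Filled T ∘ ι) → FG.IsZeroForcingSet R → FH.Filled T c
  zeroForcing⇒Filled-c R⊆ zfs = [ id , subst (FH.Filled _) ι-u ] (Filled-lift R⊆ (zfs u))

  insert-embed-Filled-c : ∀ {S T} → T ∘ ι ≗ S → ∀ a p
                        → FG.IsZeroForcingSet (FG.insert a S) → FH.Filled (FH.insert (embed a p) T) c
  insert-embed-Filled-c {S} {T} T∘ι≗S a p =
    zeroForcing⇒Filled-c (PG.insert-⊆ filled-a (λ z Sz → FH.initial (PH.insert-⊇ {S = T} (trans (T∘ι≗S z) Sz))))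
    where
    filled-a : FH.Filled (FH.insert (embed a p) T) (ι a)
    filled-a = subst (FH.Filled _) (sym (ι-embed a p)) (FH.initial (PH.insert-self (embed a p) T))

module VertexSum {n m} (G : SimpleGraph n) (G' : SimpleGraph m) (u : Fin n) (u' : Fin m) where
  adjH : SumVertex n m u u' → SumVertex n m u u' → Bool
  adjH = vertexSumAdj G G' u u'

  leftBranch : Branch G u adjH v
  leftBranch = record
    { embed           = left
    ; embed-injective = λ { refl → refl }
    ; embed≢c         = λ ()
    ; adj-embed       = λ _ _ _ _ → refl
    ; adj-embed-c     = λ _ _ → refl
    ; embed-neighbour = λ { _ _ (left y q) _ → inj₂ (y , q , refl) ; _ _ v _ → inj₁ refl }
    }

  rightBranch : Branch G' u' adjH v
  rightBranch = record
    { embed           = right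
    ; embed-injective = λ { refl → refl }
    ; embed≢c         = λ ()
    ; adj-embed       = λ _ _ _ _ → refl
    ; adj-embed-c     = λ _ _ → refl
    ; embed-neighbour = λ { _ _ (right y q) _ → inj₂ (y , q , refl) ; _ _ v _ → inj₁ refl }
    }

  module L = BranchProperties _≟V_ leftBranch
  module R = BranchProperties _≟V_ rightBranch
  module PH = ZeroForcingProperties _≟V_ adjH

  sumSet∘ιL≗ : ∀ {S S'} → S u ≡ false → sumSet S S' ∘ L.ι ≗ S
  sumSet∘ιL≗ {S} {S'} Su = L.pullback-≗ {sumSet S S'} (sym Su) (λ _ _ → refl)

  sumSet∘ιR≗ : ∀ {S S'} → S' u' ≡ false → sumSet S S' ∘ R.ι ≗ S'
  sumSet∘ιR≗ {S} {S'} S'u' = R.pullback-≗ {sumSet S S'} (sym S'u') (λ _ _ → refl)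

  sumSet-forcingClosed : ∀ {S S'} → S u ≡ false → S' u' ≡ false
                       → L.PG.IsForcingClosed S → R.PG.IsForcingClosed S'
                       → PH.IsForcingClosed (sumSet S S')
  sumSet-forcingClosed Su S'u' closed closed' (left a p)  = L.embed-forcingClosed closed (sumSet∘ιL≗ Su) a p
  sumSet-forcingClosed Su S'u' closed closed' (right a p) = R.embed-forcingClosed closed' (sumSet∘ιR≗ S'u') a p
  sumSet-forcingClosed Su S'u' closed closed' v           = λ _ ()

theorem5p6 : ∀ {n m} (G : SimpleGraph n) (G' : SimpleGraph m) (u : Fin n) (u' : Fin m)
             (S : Fin n → Bool) (S' : Fin m → Bool)
             → S u ≡ false → S' u' ≡ false
             → ZF.IsMaximalFailedZeroForcingSet G S
             → ZF.IsMaximalFailedZeroForcingSet G' S'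
             → ZFsum.IsFailedZeroForcingSet G G' u u' (sumSet S S')
               × (ZFsum.IsMaximalFailedZeroForcingSet G G' u u' (sumSet S S')
                  ⇔ ZFsum.IsZeroForcingSet G G' u u' (ZFsum.insert G G' u u' v (sumSet S S')))
theorem5p6 G G' u u' S S' Su S'u' maxS maxS' =
  failed , mk⇔ (λ maxSum → proj₂ maxSum v refl) (λ zfs-v → failed , maximal zfs-v)
  where
  open VertexSum G G' u u'
  open ZFsum G G' u u'

  closed : PH.IsForcingClosed (sumSet S S')
  closed = sumSet-forcingClosed Su S'u' (L.PG.maximalFailed⇒forcingClosed maxS)
                                        (R.PG.maximalFailed⇒forcingClosed maxS')

  failed : IsFailedZeroForcingSet (sumSet S S')
  failed zfs with PH.Filled⇒∈ closed (zfs v)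
  ... | ()

  maximal : IsZeroForcingSet (insert v (sumSet S S'))
          → ∀ x → sumSet S S' x ≡ false → IsZeroForcingSet (insert x (sumSet S S'))
  maximal zfs-v (left a p) Sa =
    PH.IsZeroForcingSet-exchange (L.insert-embed-Filled-c (sumSet∘ιL≗ Su) a p (proj₂ maxS a Sa)) zfs-v
  maximal zfs-v (right a p) S'a =
    PH.IsZeroForcingSet-exchange (R.insert-embed-Filled-c (sumSet∘ιR≗ S'u') a p (proj₂ maxS' a S'a)) zfs-v
  maximal zfs-v v _ = zfs-v
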